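{- For every Slick rule $r$, the proposition $\mathit{safe}(r)$ is decidable, i.e., there is a function $\mathit{dec}\text{ - }\mathit{safe}$ that for every rule $r$ returns either a proof of $\mathit{safe}(r)$ or a proof of $\neg\mathit{safe}(r)$.
   Context: Rosetrees over a type $t$: $\mathit{rosetree}(t) ::= \mathit{Leaf}(t) \mid \mathit{Node}(\mathit{list}(\mathit{rosetree}(t)))$ (finite lists). Constants: $\mathit{constant} ::= \mathit{Var}(\mathsf{string}) \mid \mathit{Lit}(\mathsf{string})$; atoms: $\mathit{atom} := \mathit{rosetree}(\mathit{constant})$. Signs: $\mathit{Pos}\mid\mathit{Neg}$. Conditions: $\mathit{cond} ::= \mathit{True}(\mathit{atom})\mid\mathit{Same}(\mathit{list}(\mathit{atom}))\mid\mathit{Diff}(\mathit{list}(\mathit{atom}))$. A rule is a pair $(h,b)$ with head $h$ an atom and body $b$ a finite list of pairs (sign, condition). The relation $\mathit{has}\text{ - }\mathit{var}(v,a)$ (string $v$, atom $a$) is inductively defined by: $\mathit{has}\text{ - }\mathit{var}(v,\mathit{Leaf}(\mathit{Var}(v)))$; and if $\mathit{has}\text{ - }\mathit{var}(v,a)$ and $a$ is an element of the list $l$, then $\mathit{has}\text{ - }\mathit{var}(v,\mathit{Node}(l))$. A rule $(h,b)$ is safe, $\mathit{safe}((h,b))$, iff for every string $v$ with $\mathit{has}\text{ - }\mathit{var}(v,h)$ there exists an atom $a$ with $(\mathit{Pos},\mathit{True}(a))\in b$ and $\mathit{has}\text{ - }\mathit{var}(v,a)$. -}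

module Defs where

open import Data.String using (String)
open import Data.List using (List)
open import Data.List.Membership.Propositional using (_∈_)
open import Data.Product using (_×_; _,_; ∃-syntax)

data Rosetree (T : Set) : Set where
  Leaf : T → Rosetree T
  Node : List (Rosetree T) → Rosetree T

data Constant : Set where
  Var : String → Constant
  Lit : String → Constant

Atom : Set
Atom = Rosetree Constant

data Sign : Set where
  Pos Neg : Sign

data Cond : Set where
  True : Atom → Cond
  Same : List Atom → Cond
  Diff : List Atom → Cond

Rule : Set
Rule = Atom × List (Sign × Cond)

data HasVar (v : String) : Atom → Set where
  hv-leaf : HasVar v (Leaf (Var v))
  hv-node : ∀ {a l} → HasVar v a → a ∈ l → HasVar v (Node l)

Safe : Rule → Set
Safe (h , b) = ∀ (v : String) → HasVar v h → ∃[ a ] ((Pos , True a) ∈ b × HasVar v a)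

{-# OPTIONS --safe #-}
module Submission where

-- The variables of an atom form a finite, computable list, and a variable is
-- bound by a body exactly when some positive literal True a with the variable
-- in a is among its finitely many literals; so safety is a finite conjunction
-- of finite disjunctions of decidable tests.

open import Defs
open import Data.Empty using (⊥)
open import Data.List using (List; []; _∷_; _++_)
open import Data.List.Membership.Propositional using (_∈_; find; lose)
open import Data.List.Membership.Propositional.Properties using (∈-++⁺ˡ; ∈-++⁺ʳ; ∈-++⁻)
open import Data.String using (String; _≟_)
open import Data.List.Membership.DecPropositional _≟_ using (_∈?_)
open import Data.List.Relation.Unary.All as All using (All; all?)
open import Data.List.Relation.Unary.Any using (Any; here; there; any?)
open import Data.Product using (_×_; _,_; ∃-syntax)
open import Data.Sum using (inj₁; inj₂)
open import Function.Bundles using (_⇔_; mk⇔; module Equivalence)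
open import Relation.Binary.PropositionalEquality using (refl)
open import Relation.Nullary using (Dec; no)
import Relation.Nullary.Decidable as Dec

private
  variable
    v : String
    a : Atom
    as : List Atom
    b : List (Sign × Cond)

mutual
  vars : Atom → List String
  vars (Leaf (Var w)) = w ∷ []
  vars (Leaf (Lit _)) = []
  vars (Node as) = varsᴸ as

  varsᴸ : List Atom → List String
  varsᴸ [] = []
  varsᴸ (a ∷ as) = vars a ++ varsᴸ as

mutual
  HasVar⇒∈vars : HasVar v a → v ∈ vars a
  HasVar⇒∈vars hv-leaf = here refl
  HasVar⇒∈vars (hv-node hv a∈as) = HasVar⇒∈varsᴸ hv a∈as

  HasVar⇒∈varsᴸ : HasVar v a → a ∈ as → v ∈ varsᴸ as
  HasVar⇒∈varsᴸ hv (here refl) = ∈-++⁺ˡ (HasVar⇒∈vars hv)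
  HasVar⇒∈varsᴸ {as = a ∷ _} hv (there a′∈as) = ∈-++⁺ʳ (vars a) (HasVar⇒∈varsᴸ hv a′∈as)

mutual
  ∈vars⇒HasVar : ∀ a → v ∈ vars a → HasVar v a
  ∈vars⇒HasVar (Leaf (Var _)) (here refl) = hv-leaf
  ∈vars⇒HasVar (Node as) v∈ with ∈varsᴸ⇒HasVar as v∈
  ... | a , a∈as , hv = hv-node hv a∈as

  ∈varsᴸ⇒HasVar : ∀ as → v ∈ varsᴸ as → ∃[ a ] (a ∈ as × HasVar v a)
  ∈varsᴸ⇒HasVar (a ∷ as) v∈ with ∈-++⁻ (vars a) v∈
  ... | inj₁ v∈a = a , here refl , ∈vars⇒HasVar a v∈a
  ... | inj₂ v∈as with ∈varsᴸ⇒HasVar as v∈as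
  ...   | a′ , a′∈as , hv = a′ , there a′∈as , hv

HasVar? : ∀ v a → Dec (HasVar v a)
HasVar? v a = Dec.map′ (∈vars⇒HasVar a) HasVar⇒∈vars (v ∈? vars a)

BindsVar : String → Sign × Cond → Set
BindsVar v (Pos , True a) = HasVar v a
BindsVar v _ = ⊥

BindsVar? : ∀ v l → Dec (BindsVar v l)
BindsVar? v (Pos , True a) = HasVar? v a
BindsVar? v (Pos , Same _) = no λ ()
BindsVar? v (Pos , Diff _) = no λ ()
BindsVar? v (Neg , _) = no λ ()

bound⇔Any-BindsVar : (∃[ a ] ((Pos , True a) ∈ b × HasVar v a)) ⇔ Any (BindsVar v) b
bound⇔Any-BindsVar = mk⇔ (λ (a , l∈b , hv) → lose l∈b hv) (λ p → witness (find p))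
  where
  witness : ∃[ l ] (l ∈ b × BindsVar v l) → ∃[ a ] ((Pos , True a) ∈ b × HasVar v a)
  witness ((Pos , True a) , l∈b , hv) = a , l∈b , hv

All-Any-BindsVar⇔Safe : ∀ h b → All (λ v → Any (BindsVar v) b) (vars h) ⇔ Safe (h , b)
All-Any-BindsVar⇔Safe h b = mk⇔
  (λ all v hv → from bound⇔Any-BindsVar (All.lookup all (HasVar⇒∈vars hv)))
  (λ safe → All.tabulate λ {v} v∈h → to bound⇔Any-BindsVar (safe v (∈vars⇒HasVar h v∈h)))
  where open Equivalence

mainTheorem7 : (r : Rule) → Dec (Safe r)
mainTheorem7 (h , b) =
  Dec.map (All-Any-BindsVar⇔Safe h b) (all? (λ v → any? (BindsVar? v) b) (vars h))
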